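{- Let $\gamma\in Tp(/)$ and let $\Gamma$ be a non-empty finite sequence of types in $Tp(/)$. Then $\mathbf{L}(/\to)\vdash\Gamma\to\gamma$ if and only if there exist $n\ge 0$, types $\beta_1,\dots,\beta_n\in Tp(/)$ and non-empty sequences $\Delta_1,\dots,\Delta_n$ of types such that $\Gamma=\alpha,\Delta_1,\dots,\Delta_n$ where $\alpha=(\cdots((\gamma/\beta_n)/\beta_{n-1})/\cdots)/\beta_1$, and $\mathbf{L}(/\to)\vdash\Delta_k\to\beta_k$ for every $1\le k\le n$.
   Context: Fix a finite set $Pr$ of primitive types. $Tp(/)$ is the smallest set containing $Pr$ and closed under $\alpha,\beta\mapsto\alpha/\beta$ (fully parenthesised). A sequent is $\Gamma\to\alpha$ with $\Gamma$ a finite non-empty sequence of types. The calculus $\mathbf{L}(/\to)$ has: Axiom $\alpha\to\alpha$; Cut: from $\Gamma,\alpha,\Theta\to\beta$ and $\Delta\to\alpha$ infer $\Gamma,\Delta,\Theta\to\beta$; and $(/\to)$: from $\Gamma\to\alpha$ and $\Delta,\beta,\Theta\to\gamma$ infer $\Delta,(\beta/\alpha),\Gamma,\Theta\to\gamma$ (with $\Delta,\Theta$ possibly empty). For $n=0$ the condition reads $\Gamma=\gamma$. -}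

module Defs where

open import Data.Nat using (ℕ)
open import Data.Fin using (Fin)
open import Data.List using (List; []; _∷_; _++_; [_])

infixl 30 _/_
data Tp (k : ℕ) : Set where
  prim : Fin k → Tp k
  _/_  : Tp k → Tp k → Tp k

-- Derivability in L(/→). Antecedents are lists; non-emptiness is preserved
-- by all rules (axiom has a one-element antecedent).
infix 4 _⊢_
data _⊢_ {k : ℕ} : List (Tp k) → Tp k → Set where
  ax   : ∀ {α} → [ α ] ⊢ α
  cut  : ∀ {Γ α Θ β Δ} → (Γ ++ α ∷ Θ) ⊢ β → Δ ⊢ α → (Γ ++ Δ ++ Θ) ⊢ β
  /L   : ∀ {Γ α Δ β Θ γ} → Γ ⊢ α → (Δ ++ β ∷ Θ) ⊢ γ
       → (Δ ++ (β / α) ∷ Γ ++ Θ) ⊢ γ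

-- prefix γ [β₁,…,βₙ] = (⋯((γ/βₙ)/βₙ₋₁)/⋯)/β₁
prefix : ∀ {k} → Tp k → List (Tp k) → Tp k
prefix γ []       = γ
prefix γ (β ∷ βs) = prefix γ βs / β

data NonEmpty {A : Set} : List A → Set where
  nonEmpty : ∀ {x xs} → NonEmpty (x ∷ xs)

-- Head forms are preserved by every rule: an axiom is the case n = 0; a (/→)
-- or cut acting on the head type extends the argument list (for a cut, by the
-- arguments of the head form of the cut premise, as prefix γ (βs' ++ βs) is
-- prefix (prefix γ βs) βs'); acting anywhere else, the rule happens inside a
-- single block and is replayed on that block's derivation. Conversely a head
-- form is derived by n applications of (/→) to the axiom.
module Submission where

open import Defs
open import Data.Nat using (ℕ)
open import Data.Product using (Σ; _×_; _,_)
open import Data.List using (List; []; _∷_; _++_; concat)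
open import Data.List.Properties using (++-assoc; ∷-injective; concat-++)
open import Data.List.Relation.Binary.Pointwise using (Pointwise; []; _∷_; ++⁺)
open import Data.Sum using (_⊎_; inj₁; inj₂)
open import Data.Vec using (Vec; []; _∷_; toList; zipWith)
open import Data.Vec.Relation.Unary.All using (All; []; _∷_)
open import Relation.Binary.PropositionalEquality using (_≡_; refl; sym; trans; cong; cong₂)
open import Function.Base using (_∘_)
open import Function.Bundles using (_⇔_; mk⇔)

++-∷-≡-++ : {A : Set} (xs ys : List A) {a : A} {zs ws : List A} →
  xs ++ a ∷ zs ≡ ys ++ ws →
  (Σ (List A) λ us → (xs ≡ ys ++ us) × (ws ≡ us ++ a ∷ zs)) ⊎
  (Σ (List A) λ us → (ys ≡ xs ++ a ∷ us) × (zs ≡ us ++ ws))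
++-∷-≡-++ xs [] eq = inj₁ (xs , refl , sym eq)
++-∷-≡-++ [] (y ∷ ys) refl = inj₂ (ys , refl , refl)
++-∷-≡-++ (x ∷ xs) (y ∷ ys) eq with ∷-injective eq
... | refl , eq′ with ++-∷-≡-++ xs ys eq′
... | inj₁ (us , refl , ws≡) = inj₁ (us , refl , ws≡)
... | inj₂ (us , refl , zs≡) = inj₂ (us , refl , zs≡)

-- The replaced occurrence of a lies inside a single block.
concat-replace : {A B : Set} {R : List A → B → Set} {a : A} {xs : List A} →
  (∀ {us vs b} → R (us ++ a ∷ vs) b → R (us ++ xs ++ vs) b) →
  ∀ {xss bs} (ys zs : List A) → concat xss ≡ ys ++ a ∷ zs → Pointwise R xss bs →
  Σ (List (List A)) λ xss′ → (concat xss′ ≡ ys ++ xs ++ zs) × Pointwise R xss′ bs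
concat-replace replace [] zs () []
concat-replace replace (_ ∷ _) zs () []
concat-replace {xs = xs} replace ys zs eq (_∷_ {x = xs₁} {xs = xss} r rs)
  with ++-∷-≡-++ ys xs₁ (sym eq)
... | inj₁ (us , refl , eq′) with concat-replace replace us zs eq′ rs
...   | xss′ , eq″ , rs′ = xs₁ ∷ xss′ , concat≡ , r ∷ rs′
  where
  concat≡ : xs₁ ++ concat xss′ ≡ (xs₁ ++ us) ++ xs ++ zs
  concat≡ = trans (cong (xs₁ ++_) eq″) (sym (++-assoc xs₁ us (xs ++ zs)))
concat-replace {xs = xs} replace ys zs eq (_∷_ {xs = xss} r rs)
    | inj₂ (us , refl , refl) =
  (ys ++ xs ++ us) ∷ xss , concat≡ , replace r ∷ rs
  where
  concat≡ : (ys ++ xs ++ us) ++ concat xss ≡ ys ++ xs ++ us ++ concat xss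
  concat≡ = trans (++-assoc ys (xs ++ us) (concat xss))
                  (cong (ys ++_) (++-assoc xs us (concat xss)))

module _ {A B : Set} {R : A → B → Set} where

  Pointwise⇒zipWith : ∀ {xs ys} → Pointwise R xs ys →
    Σ ℕ λ n → Σ (Vec A n) λ xv → Σ (Vec B n) λ yv →
      (toList xv ≡ xs) × (toList yv ≡ ys) × All (λ p → p) (zipWith R xv yv)
  Pointwise⇒zipWith [] = _ , [] , [] , refl , refl , []
  Pointwise⇒zipWith (r ∷ rs) with Pointwise⇒zipWith rs
  ... | _ , xv , yv , refl , refl , rv = _ , _ ∷ xv , _ ∷ yv , refl , refl , r ∷ rv

  zipWith⇒Pointwise : ∀ {n} (xv : Vec A n) (yv : Vec B n) →
    All (λ p → p) (zipWith R xv yv) → Pointwise R (toList xv) (toList yv)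
  zipWith⇒Pointwise [] [] [] = []
  zipWith⇒Pointwise (_ ∷ xv) (_ ∷ yv) (r ∷ rv) = r ∷ zipWith⇒Pointwise xv yv rv

  All-zipWith⁻ˡ : {P : A → Set} → (∀ {x y} → R x y → P x) →
    ∀ {n} (xv : Vec A n) (yv : Vec B n) → All (λ p → p) (zipWith R xv yv) → All P xv
  All-zipWith⁻ˡ f [] [] [] = []
  All-zipWith⁻ˡ f (_ ∷ xv) (_ ∷ yv) (r ∷ rv) = f r ∷ All-zipWith⁻ˡ f xv yv rv

module _ {k : ℕ} where

  ⊢-nonEmpty : {Γ : List (Tp k)} {α : Tp k} → Γ ⊢ α → NonEmpty Γ
  ⊢-nonEmpty ax = nonEmpty
  ⊢-nonEmpty (cut {Γ = []} d e) with ⊢-nonEmpty e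
  ... | nonEmpty = nonEmpty
  ⊢-nonEmpty (cut {Γ = _ ∷ _} d e) = nonEmpty
  ⊢-nonEmpty (/L {Δ = []} d e) = nonEmpty
  ⊢-nonEmpty (/L {Δ = _ ∷ _} d e) = nonEmpty

  prefix-++ : (γ : Tp k) (βs βs′ : List (Tp k)) →
    prefix γ (βs ++ βs′) ≡ prefix (prefix γ βs′) βs
  prefix-++ γ [] βs′ = refl
  prefix-++ γ (β ∷ βs) βs′ = cong (_/ β) (prefix-++ γ βs βs′)

  record HeadForm (Γ : List (Tp k)) (γ : Tp k) : Set where
    constructor headForm
    field
      args   : List (Tp k)
      blocks : List (List (Tp k))
      shape  : Γ ≡ prefix γ args ∷ concat blocks
      derivs : Pointwise _⊢_ blocks args

  headForm⇒⊢ : ∀ {Γ γ} → HeadForm Γ γ → Γ ⊢ γ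
  headForm⇒⊢ (headForm [] [] refl []) = ax
  headForm⇒⊢ (headForm (_ ∷ βs) (_ ∷ Δs) refl (d ∷ ds)) =
    /L {Δ = []} d (headForm⇒⊢ (headForm βs Δs refl ds))

  headForm-cut : ∀ Γ {α Θ β Δ} → HeadForm (Γ ++ α ∷ Θ) β → Δ ⊢ α → HeadForm Δ α →
    HeadForm (Γ ++ Δ ++ Θ) β
  headForm-cut [] {β = β} (headForm βs Δs refl ds) _ (headForm βs′ Δs′ refl ds′) =
    headForm (βs′ ++ βs) (Δs′ ++ Δs)
      (cong₂ _∷_ (sym (prefix-++ β βs′ βs)) (concat-++ Δs′ Δs)) (++⁺ ds′ ds)
  headForm-cut (_ ∷ Γ) {Θ = Θ} (headForm βs Δs eq ds) e _ with ∷-injective eq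
  ... | refl , eq′ with concat-replace (λ d → cut d e) Γ Θ (sym eq′) ds
  ...   | Δs′ , eq″ , ds′ = headForm βs Δs′ (cong (_ ∷_) (sym eq″)) ds′

  headForm-/L : ∀ Δ {Γ α β Θ γ} → Γ ⊢ α → HeadForm (Δ ++ β ∷ Θ) γ →
    HeadForm (Δ ++ (β / α) ∷ Γ ++ Θ) γ
  headForm-/L [] {Γ} {α} d (headForm βs Δs refl ds) = headForm (α ∷ βs) (Γ ∷ Δs) refl (d ∷ ds)
  headForm-/L (_ ∷ Δ) {Θ = Θ} d (headForm βs Δs eq ds) with ∷-injective eq
  ... | refl , eq′ with concat-replace (/L d) Δ Θ (sym eq′) ds
  ...   | Δs′ , eq″ , ds′ = headForm βs Δs′ (cong (_ ∷_) (sym eq″)) ds′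

  ⊢⇒headForm : ∀ {Γ γ} → Γ ⊢ γ → HeadForm Γ γ
  ⊢⇒headForm ax = headForm [] [] refl []
  ⊢⇒headForm (cut {Γ = Γ} d e) = headForm-cut Γ (⊢⇒headForm d) e (⊢⇒headForm e)
  ⊢⇒headForm (/L {Δ = Δ} d e) = headForm-/L Δ d (⊢⇒headForm e)

  VecHeadForm : List (Tp k) → Tp k → Set₁
  VecHeadForm Γ γ = Σ ℕ λ n → Σ (Vec (Tp k) n) λ βs → Σ (Vec (List (Tp k)) n) λ Δs →
    All NonEmpty Δs ×
    (Γ ≡ prefix γ (toList βs) ∷ concat (toList Δs)) ×
    All (λ p → p) (zipWith _⊢_ Δs βs)

  headForm⇒vecHeadForm : ∀ {Γ γ} → HeadForm Γ γ → VecHeadForm Γ γ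
  headForm⇒vecHeadForm (headForm βs Δs refl ds) with Pointwise⇒zipWith ds
  ... | n , Δv , βv , refl , refl , dv =
    n , βv , Δv , All-zipWith⁻ˡ ⊢-nonEmpty Δv βv dv , refl , dv

  vecHeadForm⇒headForm : ∀ {Γ γ} → VecHeadForm Γ γ → HeadForm Γ γ
  vecHeadForm⇒headForm (_ , βv , Δv , _ , shape , dv) =
    headForm (toList βv) (toList Δv) shape (zipWith⇒Pointwise Δv βv dv)

lemma1 : {k : ℕ} (γ : Tp k) (Γ : List (Tp k)) → NonEmpty Γ →
    (Γ ⊢ γ) ⇔
    Σ ℕ (λ n → Σ (Vec (Tp k) n) (λ βs → Σ (Vec (List (Tp k)) n) (λ Δs →
    All NonEmpty Δs ×
    (Γ ≡ prefix γ (toList βs) ∷ concat (toList Δs)) ×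
    All (λ p → p) (zipWith (λ Δ β → Δ ⊢ β) Δs βs))))
lemma1 γ Γ _ = mk⇔ (headForm⇒vecHeadForm ∘ ⊢⇒headForm) (headForm⇒⊢ ∘ vecHeadForm⇒headForm)
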